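{- Let $G$ be a connected bipartite circulant graph. Then $G$ has a switching automorphism of order $2$, and $G$ is isomorphic to $K_2\otimes H$ for some graph $H$ (which may have loops).
   Context: Graphs have no multiple edges but may have loops. A switching automorphism of a bipartite graph is an automorphism mapping the vertices of one part of the bipartition into the other part. $K_2$ is the complete graph on two vertices (a single edge, no loops). The tensor product $G\otimes H$ has vertex set $V(G)\times V(H)$, with $(g,h)$ adjacent to $(g',h')$ iff $g$ is adjacent to $g'$ and $h$ is adjacent to $h'$ (a looped vertex is adjacent to itself). A graph on $N$ vertices is circulant if its vertices can be labeled by $\mathbb{Z}_N$ so that, for some set $S\subseteq\mathbb{Z}_N$ with $S=-S$, vertices $i$ and $j$ are adjacent iff $j-i\in S\pmod N$. -}

module Defs where

open import Level using (0ℓ)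
open import Data.Nat using (ℕ; zero; suc; _+_; _∸_; _%_; NonZero)
open import Data.Nat.DivMod using ()
open import Data.Fin using (Fin; toℕ; fromℕ<)
open import Data.Nat.DivMod using (m%n<n)
open import Data.Bool using (Bool; true; false; not)
open import Data.Product using (Σ; ∃; ∃-syntax; _×_; _,_)
open import Data.List using (List; []; _∷_)
open import Relation.Nullary using (¬_)
open import Relation.Binary.PropositionalEquality using (_≡_; _≢_)
open import Function.Bundles using (_↔_; Inverse)

-- A graph: a vertex set with a symmetric adjacency relation.
-- No multiple edges (adjacency is a relation); loops allowed (Adj v v may hold).
record Graph : Set₁ where
  field
    V   : Set
    Adj : V → V → Set
    sym : ∀ {u v} → Adj u v → Adj v u
open Graph public

Finite : Graph → Set
Finite G = Σ ℕ λ N → V G ↔ Fin N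

data Walk (G : Graph) : V G → V G → Set where
  here : ∀ {v} → Walk G v v
  step : ∀ {u w v} → Adj G u w → Walk G w v → Walk G u v

Connected : Graph → Set
Connected G = V G × (∀ u v → Walk G u v)

IsBipartition : (G : Graph) → (V G → Bool) → Set
IsBipartition G c =
  (∀ {u v} → Adj G u v → c u ≢ c v) ×
  (∃[ u ] c u ≡ true) × (∃[ v ] c v ≡ false)

Bipartite : Graph → Set
Bipartite G = ∃[ c ] IsBipartition G c

IsAutomorphism : (G : Graph) → (V G ↔ V G) → Set
IsAutomorphism G φ = ∀ u v → (Adj G u v → Adj G (f u) (f v)) × (Adj G (f u) (f v) → Adj G u v)
  where f = Inverse.to φ

HasOrder2 : (G : Graph) → (V G ↔ V G) → Set
HasOrder2 G φ = (∀ v → f (f v) ≡ v) × (¬ (∀ v → f v ≡ v))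
  where f = Inverse.to φ

IsSwitching : (G : Graph) → (V G → Bool) → (V G ↔ V G) → Set
IsSwitching G c φ = ∀ v → c (Inverse.to φ v) ≡ not (c v)

_≅_ : Graph → Graph → Set
G ≅ H = Σ (V G ↔ V H) λ φ →
  ∀ u v → (Adj G u v → Adj H (Inverse.to φ u) (Inverse.to φ v)) ×
          (Adj H (Inverse.to φ u) (Inverse.to φ v) → Adj G u v)

K₂ : Graph
K₂ = record { V = Bool ; Adj = λ a b → a ≡ not b ; sym = s }
  where
  s : ∀ {a b} → a ≡ not b → b ≡ not a
  s {false} {true} _ = Relation.Binary.PropositionalEquality.refl
  s {true} {false} _ = Relation.Binary.PropositionalEquality.refl

_⊗_ : Graph → Graph → Graph
G ⊗ H = record
  { V = V G × V H
  ; Adj = λ { (g , h) (g' , h') → Adj G g g' × Adj H h h' }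
  ; sym = λ { (a , b) → sym G a , sym H b } }

_-ₘ_ : ∀ {N} .{{_ : NonZero N}} → Fin N → Fin N → Fin N
_-ₘ_ {N} i j = fromℕ< (m%n<n (toℕ i + (N ∸ toℕ j)) N)

negₘ : ∀ {N} .{{_ : NonZero N}} → Fin N → Fin N
negₘ {N} j = fromℕ< (m%n<n (N ∸ toℕ j) N)

-- Circulant: vertices labelled bijectively by ℤ_N, with a connection set S = -S
-- such that i ~ j iff j - i ∈ S.
Circulant : Graph → Set₁
Circulant G =
  Σ ℕ λ N → Σ (NonZero N) λ nz →
  Σ (V G ↔ Fin N) λ ℓ →
  Σ (Fin N → Set) λ S →
    (∀ s → S s → S (negₘ {{nz}} s)) ×
    (∀ u v → (Adj G u v → S (_-ₘ_ {{nz}} (Inverse.to ℓ v) (Inverse.to ℓ u))) ×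
             (S (_-ₘ_ {{nz}} (Inverse.to ℓ v) (Inverse.to ℓ u)) → Adj G u v))

-- Every reflection i ↦ a − i of ℤ_N is an involutive automorphism of a circulant graph on
-- ℤ_N, and for an edge u ~ w the reflection with a = u + w swaps u and w. An adjacency
-- preserving map of a properly 2-coloured graph which reverses the colour of one vertex
-- reverses the colour of every vertex reachable from it, so in a connected bipartite
-- circulant graph this reflection is a switching involution. Conversely a switching
-- involution φ of a bipartite graph with colour classes A and B identifies B with A,
-- exhibiting the graph as K₂ ⊗ H, where H has vertex set A and x ~ y in H iff x ~ φ y.
module Submission where

open import Defs hiding (sym)
open import Algebra.Properties.CommutativeSemigroup using (xy∙z≈xz∙y)
open import Axiom.UniquenessOfIdentityProofs using (module Decidable⇒UIP)
open import Data.Bool using (Bool; true; false; not; _≟_)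
open import Data.Bool.Properties using (not-involutive; not-¬; ¬-not)
open import Data.Fin using (Fin; toℕ; fromℕ<)
open import Data.Fin.Properties using (toℕ-injective; toℕ<n; toℕ-fromℕ<)
open import Data.Nat using (ℕ; _+_; _∸_; _%_; NonZero; _≤_)
open import Data.Nat.DivMod using (m%n<n; m%n%n≡m%n; [m+n]%n≡m%n; m<n⇒m%n≡m; %-distribˡ-+)
open import Data.Nat.Properties using (+-comm; +-assoc; m+[n∸m]≡n; m∸n+n≡m; <⇒≤; +-commutativeSemigroup)
open import Data.Product using (Σ; ∃₂; ∃-syntax; _×_; _,_; proj₁; proj₂)
open import Function using (_∘_; id)
open import Function.Bundles using (_↔_; Inverse; mk↔ₛ′)
open import Relation.Nullary using (¬_; contradiction)
open import Relation.Binary.PropositionalEquality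
  using (_≡_; _≢_; refl; sym; trans; cong; cong₂; subst; subst₂; module ≡-Reasoning)

module ModularArithmetic (N : ℕ) .{{_ : NonZero N}} where

  open ≡-Reasoning

  infix 4 _≈_
  _≈_ : ℕ → ℕ → Set
  m ≈ n = m % N ≡ n % N

  %-absorbˡ : ∀ m k → (m % N + k) ≈ (m + k)
  %-absorbˡ m k = begin
    (m % N + k) % N          ≡⟨ %-distribˡ-+ (m % N) k N ⟩
    (m % N % N + k % N) % N  ≡⟨ cong (λ t → (t + k % N) % N) (m%n%n≡m%n m N) ⟩
    (m % N + k % N) % N      ≡⟨ %-distribˡ-+ m k N ⟨
    (m + k) % N              ∎

  ≈-+ʳ : ∀ {m n} k → m ≈ n → (m + k) ≈ (n + k)
  ≈-+ʳ {m} {n} k m≈n = begin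
    (m + k) % N      ≡⟨ %-absorbˡ m k ⟨
    (m % N + k) % N  ≡⟨ cong (λ t → (t + k) % N) m≈n ⟩
    (n % N + k) % N  ≡⟨ %-absorbˡ n k ⟩
    (n + k) % N      ∎

  ≈-cancel-+ʳ : ∀ {m n} r → r ≤ N → (m + r) ≈ (n + r) → m ≈ n
  ≈-cancel-+ʳ {m} {n} r r≤N m+r≈n+r = begin
    m % N                  ≡⟨ [m+n]%n≡m%n m N ⟨
    (m + N) % N            ≡⟨ cong (_% N) (complete m) ⟨
    (m + r + (N ∸ r)) % N  ≡⟨ ≈-+ʳ (N ∸ r) m+r≈n+r ⟩
    (n + r + (N ∸ r)) % N  ≡⟨ cong (_% N) (complete n) ⟩
    (n + N) % N            ≡⟨ [m+n]%n≡m%n n N ⟩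
    n % N                  ∎
    where
    complete : ∀ k → k + r + (N ∸ r) ≡ k + N
    complete k = trans (+-assoc k r (N ∸ r)) (cong (k +_) (m+[n∸m]≡n r≤N))

  toℕ≤N : (i : Fin N) → toℕ i ≤ N
  toℕ≤N i = <⇒≤ (toℕ<n i)

  toℕ-injective-≈ : ∀ {i j : Fin N} → toℕ i ≈ toℕ j → i ≡ j
  toℕ-injective-≈ {i} {j} i≈j =
    toℕ-injective (trans (sym (m<n⇒m%n≡m (toℕ<n i))) (trans i≈j (m<n⇒m%n≡m (toℕ<n j))))

  [x-ₘy]+y≈x : ∀ (x y : Fin N) → (toℕ (x -ₘ y) + toℕ y) ≈ toℕ x
  [x-ₘy]+y≈x x y = begin
    (toℕ (x -ₘ y) + toℕ y) % N                  ≡⟨ cong (λ t → (t + toℕ y) % N) (toℕ-fromℕ< (m%n<n _ N)) ⟩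
    ((toℕ x + (N ∸ toℕ y)) % N + toℕ y) % N     ≡⟨ %-absorbˡ (toℕ x + (N ∸ toℕ y)) (toℕ y) ⟩
    (toℕ x + (N ∸ toℕ y) + toℕ y) % N           ≡⟨ cong (_% N) (+-assoc (toℕ x) (N ∸ toℕ y) (toℕ y)) ⟩
    (toℕ x + ((N ∸ toℕ y) + toℕ y)) % N         ≡⟨ cong (λ t → (toℕ x + t) % N) (m∸n+n≡m (toℕ≤N y)) ⟩
    (toℕ x + N) % N                             ≡⟨ [m+n]%n≡m%n (toℕ x) N ⟩
    toℕ x % N                                   ∎

  -ₘ-unique : ∀ {x y z : Fin N} → (toℕ z + toℕ y) ≈ toℕ x → x -ₘ y ≡ z
  -ₘ-unique {x} {y} {z} z+y≈x =
    toℕ-injective-≈ (≈-cancel-+ʳ (toℕ y) (toℕ≤N y) (trans ([x-ₘy]+y≈x x y) (sym z+y≈x)))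

  a-ₘ[a-ₘi]≡i : ∀ (a i : Fin N) → a -ₘ (a -ₘ i) ≡ i
  a-ₘ[a-ₘi]≡i a i = -ₘ-unique (trans (cong (_% N) (+-comm (toℕ i) (toℕ (a -ₘ i)))) ([x-ₘy]+y≈x a i))

  [a-ₘy]-ₘ[a-ₘx]≡x-ₘy : ∀ (a x y : Fin N) → (a -ₘ y) -ₘ (a -ₘ x) ≡ x -ₘ y
  [a-ₘy]-ₘ[a-ₘx]≡x-ₘy a x y = -ₘ-unique (≈-cancel-+ʳ (toℕ y) (toℕ≤N y) (begin
    (d + p + toℕ y) % N            ≡⟨ cong (_% N) (xy∙z≈xz∙y +-commutativeSemigroup d p (toℕ y)) ⟩
    (d + toℕ y + p) % N            ≡⟨ ≈-+ʳ p ([x-ₘy]+y≈x x y) ⟩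
    (toℕ x + p) % N                ≡⟨ cong (_% N) (+-comm (toℕ x) p) ⟩
    (p + toℕ x) % N                ≡⟨ [x-ₘy]+y≈x a x ⟩
    toℕ a % N                      ≡⟨ [x-ₘy]+y≈x a y ⟨
    (toℕ (a -ₘ y) + toℕ y) % N     ∎))
    where
    d = toℕ (x -ₘ y)
    p = toℕ (a -ₘ x)

  _+ₘ_ : Fin N → Fin N → Fin N
  i +ₘ j = fromℕ< (m%n<n (toℕ i + toℕ j) N)

  i+ₘj-ₘj≡i : ∀ (i j : Fin N) → (i +ₘ j) -ₘ j ≡ i
  i+ₘj-ₘj≡i i j = -ₘ-unique (begin
    (toℕ i + toℕ j) % N            ≡⟨ m%n%n≡m%n (toℕ i + toℕ j) N ⟨
    (toℕ i + toℕ j) % N % N        ≡⟨ cong (_% N) (toℕ-fromℕ< (m%n<n (toℕ i + toℕ j) N)) ⟨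
    toℕ (i +ₘ j) % N               ∎)

involution-isAutomorphism : (G : Graph) (f : V G → V G) (involutive : ∀ v → f (f v) ≡ v) →
  (∀ {u v} → Adj G u v → Adj G (f u) (f v)) →
  IsAutomorphism G (mk↔ₛ′ f f involutive involutive)
involution-isAutomorphism G f involutive hom u v =
  hom , λ fu~fv → subst₂ (Adj G) (involutive u) (involutive v) (hom fu~fv)

walk⇒edge : ∀ {G u v} → Walk G u v → u ≢ v → ∃₂ (Adj G)
walk⇒edge here           u≢u = contradiction refl u≢u
walk⇒edge (step u~w _)  _   = _ , _ , u~w

bipartition⇒edge : ∀ {G c} → Connected G → IsBipartition G c → ∃₂ (Adj G)
bipartition⇒edge {c = c} (_ , walk) (_ , (u , cu≡true) , (v , cv≡false)) =
  walk⇒edge (walk u v) λ u≡v → not-¬ cu≡true (trans (cong c u≡v) cv≡false)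

Proper : (G : Graph) → (V G → Bool) → Set
Proper G c = ∀ {u v} → Adj G u v → c u ≢ c v

module Switching (G : Graph) {c : V G → Bool} (proper : Proper G c)
  {f : V G → V G} (hom : ∀ {u v} → Adj G u v → Adj G (f u) (f v)) where

  Switches : V G → Set
  Switches v = c (f v) ≡ not (c v)

  switches-adjacent : ∀ {u w} → Adj G u w → Switches u → Switches w
  switches-adjacent {u} {w} u~w fu-switches = begin
    c (f w)          ≡⟨ ¬-not (proper (hom u~w) ∘ sym) ⟩
    not (c (f u))    ≡⟨ cong not fu-switches ⟩
    not (not (c u))  ≡⟨ not-involutive (c u) ⟩
    c u              ≡⟨ ¬-not (proper u~w) ⟩
    not (c w)        ∎
    where open ≡-Reasoning

  switches-along : ∀ {u w} → Walk G u w → Switches u → Switches w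
  switches-along here            = id
  switches-along (step u~w walk) = switches-along walk ∘ switches-adjacent u~w

module CirculantReflection (G : Graph) {N : ℕ} .{{_ : NonZero N}} (ℓ : V G ↔ Fin N)
  (S : Fin N → Set)
  (adj⇔S : ∀ u v → (Adj G u v → S (Inverse.to ℓ v -ₘ Inverse.to ℓ u)) ×
                   (S (Inverse.to ℓ v -ₘ Inverse.to ℓ u) → Adj G u v)) where

  open ModularArithmetic N
  open Inverse ℓ renaming (to to label; from to vertex)

  reflect : Fin N → V G → V G
  reflect a v = vertex (a -ₘ label v)

  reflect-involutive : ∀ a v → reflect a (reflect a v) ≡ v
  reflect-involutive a v = begin
    vertex (a -ₘ label (vertex (a -ₘ label v)))  ≡⟨ cong (vertex ∘ (a -ₘ_)) (strictlyInverseˡ _) ⟩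
    vertex (a -ₘ (a -ₘ label v))                 ≡⟨ cong vertex (a-ₘ[a-ₘi]≡i a (label v)) ⟩
    vertex (label v)                             ≡⟨ strictlyInverseʳ v ⟩
    v                                            ∎
    where open ≡-Reasoning

  reflect-preserves-adj : ∀ a {u v} → Adj G u v → Adj G (reflect a u) (reflect a v)
  reflect-preserves-adj a {u} {v} u~v =
    proj₂ (adj⇔S (reflect a u) (reflect a v))
          (subst S (sym differences) (proj₁ (adj⇔S v u) (Graph.sym G u~v)))
    where
    differences : label (reflect a v) -ₘ label (reflect a u) ≡ label u -ₘ label v
    differences = trans (cong₂ _-ₘ_ (strictlyInverseˡ _) (strictlyInverseˡ _))
                        ([a-ₘy]-ₘ[a-ₘx]≡x-ₘy a (label u) (label v))

  reflection : Fin N → V G ↔ V G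
  reflection a = mk↔ₛ′ (reflect a) (reflect a) (reflect-involutive a) (reflect-involutive a)

  reflection-isAutomorphism : ∀ a → IsAutomorphism G (reflection a)
  reflection-isAutomorphism a =
    involution-isAutomorphism G (reflect a) (reflect-involutive a) (reflect-preserves-adj a)

  reflect-swaps : ∀ u w → reflect (label w +ₘ label u) u ≡ w
  reflect-swaps u w = trans (cong vertex (i+ₘj-ₘj≡i (label w) (label u))) (strictlyInverseʳ w)

circulant⇒switching-involution : (G : Graph) → Circulant G → Connected G →
  ∀ c → IsBipartition G c →
  ∃[ φ ] (IsAutomorphism G φ × HasOrder2 G φ × IsSwitching G c φ)
circulant⇒switching-involution G (N , nz , ℓ , S , _ , adj⇔S) connected@(v₀ , walk) c bip@(proper , _)
  with u , w , u~w ← bipartition⇒edge connected bip =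
  reflection a , reflection-isAutomorphism a , (reflect-involutive a , non-identity) , switches
  where
  open CirculantReflection G {{nz}} ℓ S adj⇔S
  open ModularArithmetic N {{nz}} using (_+ₘ_)

  a : Fin N
  a = Inverse.to ℓ w +ₘ Inverse.to ℓ u

  open Switching G proper (reflect-preserves-adj a)

  switches : ∀ v → Switches v
  switches v = switches-along (walk u v) (trans (cong c (reflect-swaps u w)) (¬-not (proper u~w ∘ sym)))

  non-identity : ¬ (∀ v → reflect a v ≡ v)
  non-identity fixes = not-¬ (cong c (fixes v₀)) (switches v₀)

module TensorDecomposition (G : Graph) {c : V G → Bool} (proper : Proper G c)
  (φ : V G ↔ V G) (automorphism : IsAutomorphism G φ)
  (involutive : ∀ v → Inverse.to φ (Inverse.to φ v) ≡ v) (switching : IsSwitching G c φ) where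

  open Inverse φ using () renaming (to to f)
  open Decidable⇒UIP _≟_ using (≡-irrelevant)

  Class : Set
  Class = Σ (V G) λ v → c v ≡ true

  H : Graph
  H = record
    { V   = Class
    ; Adj = λ x y → Adj G (proj₁ x) (f (proj₁ y))
    ; sym = λ {x} {y} → H-sym x y
    }
    where
    H-sym : ∀ (x y : Class) → Adj G (proj₁ x) (f (proj₁ y)) → Adj G (proj₁ y) (f (proj₁ x))
    H-sym (x , _) (y , _) x~fy =
      Graph.sym G (subst (Adj G (f x)) (involutive y) (proj₁ (automorphism x (f y)) x~fy))

  class-≡ : ∀ {x y} → x ≡ y → (p : c x ≡ true) (q : c y ≡ true) → _≡_ {A = Class} (x , p) (y , q)
  class-≡ refl p q = cong (_ ,_) (≡-irrelevant p q)

  switch-false : ∀ {v} → c v ≡ false → c (f v) ≡ true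
  switch-false {v} cv≡false = trans (switching v) (cong not cv≡false)

  encode-with : (v : V G) (b : Bool) → c v ≡ b → Bool × Class
  encode-with v true  cv≡true  = true , v , cv≡true
  encode-with v false cv≡false = false , f v , switch-false cv≡false

  decode : Bool × Class → V G
  decode (true  , x , _) = x
  decode (false , x , _) = f x

  decode-encode-with : ∀ v b (cv≡b : c v ≡ b) → decode (encode-with v b cv≡b) ≡ v
  decode-encode-with v true  _ = refl
  decode-encode-with v false _ = involutive v

  encode-with-class : ∀ x (p : c x ≡ true) b (q : c x ≡ b) → encode-with x b q ≡ (true , x , p)
  encode-with-class x p true  q = cong (λ r → true , x , r) (≡-irrelevant q p)
  encode-with-class x p false q = contradiction q (not-¬ p)

  encode-with-switched : ∀ x (p : c x ≡ true) b (q : c (f x) ≡ b) → encode-with (f x) b q ≡ (false , x , p)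
  encode-with-switched x p true  q = contradiction (trans (switching x) (cong not p)) (not-¬ q)
  encode-with-switched x p false q = cong (false ,_) (class-≡ (involutive x) (switch-false q) p)

  encode : V G → Bool × Class
  encode v = encode-with v (c v) refl

  encode-decode : ∀ y → encode (decode y) ≡ y
  encode-decode (true  , x , p) = encode-with-class x p (c x) refl
  encode-decode (false , x , p) = encode-with-switched x p (c (f x)) refl

  vertices : V G ↔ (Bool × Class)
  vertices = mk↔ₛ′ encode decode encode-decode (λ v → decode-encode-with v (c v) refl)

  encode-with-adj : ∀ u bu (pu : c u ≡ bu) v bv (pv : c v ≡ bv) →
    (Adj G u v → Adj (K₂ ⊗ H) (encode-with u bu pu) (encode-with v bv pv)) ×
    (Adj (K₂ ⊗ H) (encode-with u bu pu) (encode-with v bv pv) → Adj G u v)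
  encode-with-adj u true  pu v true  pv =
    (λ u~v → contradiction (trans pu (sym pv)) (proper u~v)) , λ { (() , _) }
  encode-with-adj u true  pu v false pv =
    (λ u~v → refl , subst (Adj G u) (sym (involutive v)) u~v) ,
    (λ { (_ , u~ffv) → subst (Adj G u) (involutive v) u~ffv })
  encode-with-adj u false pu v true  pv =
    (λ u~v → refl , proj₁ (automorphism u v) u~v) ,
    (λ { (_ , fu~fv) → proj₂ (automorphism u v) fu~fv })
  encode-with-adj u false pu v false pv =
    (λ u~v → contradiction (trans pu (sym pv)) (proper u~v)) , λ { (() , _) }

  G≅K₂⊗H : G ≅ (K₂ ⊗ H)
  G≅K₂⊗H = vertices , λ u v → encode-with-adj u (c u) refl v (c v) refl

switching-involution⇒≅K₂⊗ : (G : Graph) {c : V G → Bool} → Proper G c →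
  ∃[ φ ] (IsAutomorphism G φ × HasOrder2 G φ × IsSwitching G c φ) → ∃[ H ] (G ≅ (K₂ ⊗ H))
switching-involution⇒≅K₂⊗ G proper (φ , automorphism , (involutive , _) , switching) = H , G≅K₂⊗H
  where open TensorDecomposition G proper φ automorphism involutive switching

theorem9 : (G : Graph) → Circulant G → Connected G → Bipartite G →
    (∀ c → IsBipartition G c →
      ∃[ φ ] (IsAutomorphism G φ × HasOrder2 G φ × IsSwitching G c φ))
    × (∃[ H ] (G ≅ (K₂ ⊗ H)))
theorem9 G circulant connected (c , bip@(proper , _)) =
  switching-involution , switching-involution⇒≅K₂⊗ G proper (switching-involution c bip)
  where
  switching-involution : ∀ c → IsBipartition G c →
    ∃[ φ ] (IsAutomorphism G φ × HasOrder2 G φ × IsSwitching G c φ)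
  switching-involution = circulant⇒switching-involution G circulant connected
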